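{- Let $G$ and $H$ be finite simple graphs, and let $i_G$ be the number of isolated vertices of $G$. Then $$\rho_o(G\circ H)=\begin{cases}\rho_o(G)+i_G\rho_o(H)-i_G, & \text{if } H \text{ has an isolated vertex},\\ \rho(G)+i_G\rho_o(H)-i_G, & \text{otherwise.}\end{cases}$$
   Context: For a graph $G$, a packing is a set $P\subseteq V(G)$ with $N_G[u]\cap N_G[v]=\emptyset$ for distinct $u,v\in P$ (closed neighborhoods), and $\rho(G)$ is the maximum size of a packing; an open packing is a set $P$ with $N_G(u)\cap N_G(v)=\emptyset$ for distinct $u,v\in P$ (open neighborhoods), and $\rho_o(G)$ is the maximum size of an open packing. The lexicographic product $G\circ H$ has vertex set $V(G)\times V(H)$, with $(g,h)$ adjacent to $(g',h')$ iff either $gg'\in E(G)$, or $g=g'$ and $hh'\in E(H)$. -}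

module Defs where

open import Data.Bool using (Bool; true; false; _∧_; _∨_; not; if_then_else_)
open import Data.Nat using (ℕ; zero; suc; _*_; _⊔_)
open import Data.Fin using (Fin; remQuot; _≟_)
open import Data.List using (List; []; _∷_; _++_; map; filter; foldr; length; allFin)
open import Data.Bool.ListAction using (all; any)
open import Data.Vec using (Vec; []; _∷_)
open import Data.Fin.Subset using (Subset; _∈_; ∣_∣)
open import Data.Fin.Subset.Properties using (_∈?_)
open import Data.Product using (_×_; _,_; proj₁; proj₂)
open import Relation.Binary.PropositionalEquality using (_≡_)
open import Relation.Nullary.Decidable using (⌊_⌋)

record Graph : Set where
  field
    n     : ℕ
    adj   : Fin n → Fin n → Bool
    sym   : ∀ u v → adj u v ≡ adj v u
    irref : ∀ v → adj v v ≡ false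
open Graph public

inN : (G : Graph) → Fin (n G) → Fin (n G) → Bool
inN G v w = adj G v w

inN[] : (G : Graph) → Fin (n G) → Fin (n G) → Bool
inN[] G v w = ⌊ v ≟ w ⌋ ∨ adj G v w

disjointN : (G : Graph) → Fin (n G) → Fin (n G) → Bool
disjointN G u v = all (λ w → not (inN G u w ∧ inN G v w)) (allFin (n G))

disjointN[] : (G : Graph) → Fin (n G) → Fin (n G) → Bool
disjointN[] G u v = all (λ w → not (inN[] G u w ∧ inN[] G v w)) (allFin (n G))

forDistinctPairs : ∀ {m} → (Fin m → Fin m → Bool) → Subset m → Bool
forDistinctPairs {m} c P =
  all (λ u → all (λ v →
    not (⌊ u ∈? P ⌋ ∧ ⌊ v ∈? P ⌋ ∧ not ⌊ u ≟ v ⌋) ∨ c u v)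
    (allFin m)) (allFin m)

isPacking : (G : Graph) → Subset (n G) → Bool
isPacking G = forDistinctPairs (disjointN[] G)

isOpenPacking : (G : Graph) → Subset (n G) → Bool
isOpenPacking G = forDistinctPairs (disjointN G)

allSubsets : ∀ m → List (Subset m)
allSubsets zero = [] ∷ []
allSubsets (suc m) = map (true ∷_) (allSubsets m) ++ map (false ∷_) (allSubsets m)

maxSize : ∀ {m} → (Subset m → Bool) → ℕ
maxSize {m} p = foldr _⊔_ 0 (map ∣_∣ (filter (λ P → T? (p P)) (allSubsets m)))
  where
  open import Data.Bool using (T)
  open import Data.Bool.Properties using (T?)

ρ : Graph → ℕ
ρ G = maxSize (isPacking G)

ρₒ : Graph → ℕ
ρₒ G = maxSize (isOpenPacking G)

isIsolated : (G : Graph) → Fin (n G) → Bool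
isIsolated G v = not (any (adj G v) (allFin (n G)))

hasIsolated : Graph → Bool
hasIsolated G = any (isIsolated G) (allFin (n G))

iso# : Graph → ℕ
iso# G = length (filter (λ v → T? (isIsolated G v)) (allFin (n G)))
  where
  open import Data.Bool.Properties using (T?)

pairAdj : (G H : Graph) → Fin (n G) × Fin (n H) → Fin (n G) × Fin (n H) → Bool
pairAdj G H (g , h) (g' , h') = adj G g g' ∨ (⌊ g ≟ g' ⌋ ∧ adj H h h')

-- Lexicographic product G ∘ H on Fin (n G * n H), the vertex k encoding the pair remQuot k
lexAdj : (G H : Graph) → Fin (n G * n H) → Fin (n G * n H) → Bool
lexAdj G H x y = pairAdj G H (remQuot (n H) x) (remQuot (n H) y)

private
  open import Data.Bool.Properties using (∨-comm; ∧-comm)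
  open import Relation.Binary.PropositionalEquality using (refl; cong₂) renaming (sym to ≡sym)
  open import Relation.Nullary using (yes; no)

  eqSym : ∀ {m} (a b : Fin m) → ⌊ a ≟ b ⌋ ≡ ⌊ b ≟ a ⌋
  eqSym a b with a ≟ b | b ≟ a
  ... | yes _ | yes _ = refl
  ... | no _  | no _  = refl
  ... | yes p | no q  with q (≡sym p)
  ... | ()
  eqSym a b | no q | yes p with q (≡sym p)
  ... | ()

  eqRefl : ∀ {m} (a : Fin m) → ⌊ a ≟ a ⌋ ≡ true
  eqRefl a with a ≟ a
  ... | yes _ = refl
  ... | no q with q refl
  ... | ()

lexSym : (G H : Graph) → ∀ x y → lexAdj G H x y ≡ lexAdj G H y x
lexSym G H x y = pS (remQuot (n H) x) (remQuot (n H) y)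
  where
  pS : ∀ p q → pairAdj G H p q ≡ pairAdj G H q p
  pS (g , h) (g' , h') = cong₂ _∨_ (Graph.sym G g g') (cong₂ _∧_ (eqSym g g') (Graph.sym H h h'))

lexIrr : (G H : Graph) → ∀ x → lexAdj G H x x ≡ false
lexIrr G H x = pI (remQuot (n H) x)
  where
  pI : ∀ p → pairAdj G H p p ≡ false
  pI (g , h) rewrite irref G g | eqRefl g | irref H h = refl

_∘ₗ_ : Graph → Graph → Graph
G ∘ₗ H = record
  { n = n G * n H ; adj = lexAdj G H ; sym = lexSym G H ; irref = lexIrr G H }

module Submission where

-- An open packing Q of G ∘ H meets each fibre {g} × V(H) in an open packing of H, and in at
-- most one vertex if g has a neighbour w, since two such vertices share the neighbour (w, h).
-- The shadow of Q, its projection to G together with the isolated vertices of G, is an open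
-- packing of G, and even a packing if H has no isolated vertex: when g' is adjacent to g and
-- (g, h), (g', h') ∈ Q, any k adjacent to h makes (g, k) a common neighbour. Summing over the
-- fibres gives |Q| + i_G ≤ |shadow| + i_G ρₒ(H).
-- Conversely, put a maximum open packing of H over each isolated vertex of G and S × {h₀} over
-- the other vertices, where S is a maximum (open) packing of G and h₀ a vertex of H (an
-- isolated one, if there is one); this is an open packing of G ∘ H with at least
-- |S| − i_G + i_G ρₒ(H) vertices.

open import Data.Bool using (Bool; true; false; T; not; _∧_; _∨_; if_then_else_)
open import Data.Bool.Properties using (T?; T-∨; T-∧; T-≡)
open import Data.Bool.ListAction using (all; any)
open import Data.Empty using (⊥; ⊥-elim)
open import Data.Fin using (Fin; zero; suc; _↑ˡ_; _↑ʳ_; combine; remQuot; fromℕ<; _≟_)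
open import Data.Fin.Properties using (suc-injective; 0≢1+n; remQuot-combine; *↔×)
open import Data.Fin.Subset using (Subset; ∣_∣)
import Data.Fin.Subset as Subset
open import Data.Fin.Subset.Properties using (_∈?_; ∣⊥∣≡0)
open import Data.List using ([]; _∷_; allFin; foldr; map; filter; length)
import Data.List as List
open import Data.List.Membership.Propositional using (_∈_; lose)
open import Data.List.Membership.Propositional.Properties
  using (∈-allFin; ∈-map⁺; ∈-map⁻; ∈-filter⁺; ∈-filter⁻; ∈-++⁺ˡ; ∈-++⁺ʳ)
import Data.List.Relation.Unary.All as All
open import Data.List.Relation.Unary.All.Properties using (all⁺; all⁻)
open import Data.List.Relation.Unary.Any using (here; there; satisfied)
open import Data.List.Relation.Unary.Any.Properties using (any⁺; any⁻)
open import Data.Nat using (ℕ; zero; suc; _+_; _*_; _∸_; _≤_; _⊔_; z≤n; s≤s)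
open import Data.Nat.Properties
  using ( +-0-commutativeMonoid; +-assoc; +-comm; +-identityʳ; +-mono-≤; +-monoˡ-≤; +-monoʳ-≤
        ; ≤-reflexive; ≤-trans; ≤-antisym; m≤m+n; m≤n+m; m≤m⊔n; m≤n⊔m; ⊔-sel
        ; m+n≤o⇒m≤o∸n; m≤n+o⇒m∸n≤o; module ≤-Reasoning )
open import Data.Product using (_×_; _,_; ∃; ∃-syntax; proj₁; proj₂; uncurry)
import Data.Product as Product
open import Data.Sum using (_⊎_; inj₁; inj₂)
import Data.Sum as Sum
open import Data.Vec using ([]; _∷_; lookup; tabulate)
open import Data.Vec.Properties using ([]=⇒lookup; lookup⇒[]=; lookup∘tabulate; lookup-replicate)
open import Function using (_∘_; id; _⇔_; mk⇔; Injective; Injection)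
open import Function.Bundles using (module Equivalence)
open Equivalence using (to; from)
open import Function.Properties.Inverse using (↔-sym; ↔⇒↣)
open import Relation.Binary.PropositionalEquality
open import Relation.Nullary using (¬_; yes; no)
open import Relation.Nullary.Decidable using (⌊_⌋; toWitness; fromWitness; decidable-stable)
open import Algebra.Properties.CommutativeMonoid.Sum +-0-commutativeMonoid
  using (sum; sum-cong-≗; ∑-distrib-+)

open import Defs hiding (sym)

iverson : Bool → ℕ
iverson true  = 1
iverson false = 0

iverson≤1 : ∀ b → iverson b ≤ 1
iverson≤1 true  = s≤s z≤n
iverson≤1 false = z≤n

count : ∀ {m} → (Fin m → Bool) → ℕ
count f = sum (iverson ∘ f)

sum-mono-≤ : ∀ {m} {f g : Fin m → ℕ} → (∀ i → f i ≤ g i) → sum f ≤ sum g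
sum-mono-≤ {zero}  f≤g = z≤n
sum-mono-≤ {suc m} f≤g = +-mono-≤ (f≤g zero) (sum-mono-≤ (f≤g ∘ suc))

sum-↑ : ∀ m {n} (f : Fin (m + n) → ℕ) → sum f ≡ sum (f ∘ (_↑ˡ n)) + sum (f ∘ (m ↑ʳ_))
sum-↑ zero    f = refl
sum-↑ (suc m) f = trans (cong (f zero +_) (sum-↑ m (f ∘ suc))) (sym (+-assoc (f zero) _ _))

sum-combine : ∀ m {n} (f : Fin (m * n) → ℕ) → sum f ≡ sum (λ g → sum (λ h → f (combine {m} g h)))
sum-combine zero    f = refl
sum-combine (suc m) {n} f =
  trans (sum-↑ n f) (cong (sum (f ∘ (_↑ˡ (m * n))) +_) (sum-combine m (f ∘ (n ↑ʳ_))))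

sum-if : ∀ {m} (p : Fin m → Bool) c → sum (λ i → if p i then c else 0) ≡ count p * c
sum-if {zero}  p c = refl
sum-if {suc m} p c with p zero
... | true  = cong (c +_) (sum-if (p ∘ suc) c)
... | false = sum-if (p ∘ suc) c

sum-weight : ∀ {m} (p s : Fin m → Bool) c →
  sum (λ i → (if p i then c else 0) + iverson (s i)) ≡ count p * c + count s
sum-weight p s c = trans (∑-distrib-+ _ (iverson ∘ s)) (cong (_+ count s) (sum-if p c))

count-cong : ∀ {m} {f g : Fin m → Bool} → (∀ i → f i ≡ g i) → count f ≡ count g
count-cong f≗g = sum-cong-≗ (cong iverson ∘ f≗g)

count-pos : ∀ {m} (f : Fin m → Bool) i → T (f i) → 1 ≤ count f
count-pos f zero    fi with f zero
... | true = s≤s z≤n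
count-pos f (suc i) fi = ≤-trans (count-pos (f ∘ suc) i fi) (m≤n+m _ (iverson (f zero)))

count-none : ∀ {m} (f : Fin m → Bool) → (∀ i → ¬ T (f i)) → count f ≡ 0
count-none {zero}  f none = refl
count-none {suc m} f none with f zero in e
... | true  = ⊥-elim (none zero (subst T (sym e) _))
... | false = count-none (f ∘ suc) (none ∘ suc)

count-subsingleton : ∀ {m} (f : Fin m → Bool) → (∀ {i j} → T (f i) → T (f j) → i ≡ j) → count f ≤ 1
count-subsingleton {zero}  f unique = z≤n
count-subsingleton {suc m} f unique with f zero in e
... | true  = ≤-reflexive (cong suc (count-none (f ∘ suc) λ i fi → 0≢1+n (unique (subst T (sym e) _) fi)))
... | false = count-subsingleton (f ∘ suc) (λ fi fj → suc-injective (unique fi fj))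

length-filter-tabulate : ∀ {A : Set} {m} (p : A → Bool) (f : Fin m → A) →
  length (filter (T? ∘ p) (List.tabulate f)) ≡ count (p ∘ f)
length-filter-tabulate {m = zero}  p f = refl
length-filter-tabulate {m = suc m} p f with p (f zero)
... | true  = cong suc (length-filter-tabulate p (f ∘ suc))
... | false = length-filter-tabulate p (f ∘ suc)

∣∣≡count-lookup : ∀ {m} (P : Subset m) → ∣ P ∣ ≡ count (lookup P)
∣∣≡count-lookup []          = refl
∣∣≡count-lookup (true ∷ P)  = cong suc (∣∣≡count-lookup P)
∣∣≡count-lookup (false ∷ P) = ∣∣≡count-lookup P

∣tabulate∣≡count : ∀ {m} (f : Fin m → Bool) → ∣ tabulate f ∣ ≡ count f
∣tabulate∣≡count f = trans (∣∣≡count-lookup (tabulate f)) (count-cong (lookup∘tabulate f))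

fibre : ∀ {m n} → (Fin (m * n) → Bool) → Fin m → Fin n → Bool
fibre {m} f g h = f (combine {m} g h)

count-fibres : ∀ {m n} (f : Fin (m * n) → Bool) → count f ≡ sum (λ g → count (fibre {m} {n} f g))
count-fibres {m} f = sum-combine m (iverson ∘ f)

count-unfibre : ∀ {m n} (R : Fin m → Fin n → Bool) →
  count (uncurry R ∘ remQuot {m} n) ≡ sum (λ g → count (R g))
count-unfibre {m} {n} R = trans (count-fibres {m} {n} (uncurry R ∘ remQuot {m} n))
  (sum-cong-≗ {m} λ g → count-cong λ h → cong (uncurry R) (remQuot-combine g h))

T-not : ∀ {b} → T (not b) ⇔ (¬ T b)
T-not {true}  = mk⇔ (λ ()) (λ ¬t → ¬t _)
T-not {false} = mk⇔ (λ _ ()) (λ _ → _)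

T-all-allFin : ∀ {m} (p : Fin m → Bool) → T (all p (allFin m)) ⇔ (∀ i → T (p i))
T-all-allFin p = mk⇔
  (λ t i → All.lookup (all⁺ p _ t) (∈-allFin i))
  (λ h → all⁻ p {allFin _} (All.tabulate (λ {i} _ → h i)))

T-any-allFin : ∀ {m} (p : Fin m → Bool) → T (any p (allFin m)) ⇔ ∃ (T ∘ p)
T-any-allFin p = mk⇔
  (λ t → satisfied (any⁻ p (allFin _) t))
  (λ (i , pi) → any⁺ p (lose {xs = allFin _} (∈-allFin i) pi))

count≤iverson-any : ∀ {m} (f : Fin m → Bool) → (∀ {i j} → T (f i) → T (f j) → i ≡ j) →
  count f ≤ iverson (any f (allFin m))
count≤iverson-any f unique with any f (allFin _) in e
... | true  = count-subsingleton f unique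
... | false = ≤-reflexive (count-none f λ i fi → subst T e (from (T-any-allFin f) (i , fi)))

T-∈? : ∀ {m} (u : Fin m) (P : Subset m) → T ⌊ u ∈? P ⌋ ⇔ T (lookup P u)
T-∈? u P = mk⇔
  (λ t → from T-≡ ([]=⇒lookup (toWitness t)))
  (λ t → fromWitness (lookup⇒[]= u P (to T-≡ t)))

T-guarded : ∀ a b d e → T (not (a ∧ b ∧ not d) ∨ e) ⇔ (T a → T b → ¬ T d → T e)
T-guarded false b     d     e = mk⇔ (λ _ ()) _
T-guarded true  false d     e = mk⇔ (λ _ _ ()) _
T-guarded true  true  true  e = mk⇔ (λ _ _ _ ¬d → ⊥-elim (¬d _)) _
T-guarded true  true  false e = mk⇔ (λ t _ _ _ → t) (λ h → h _ _ λ ())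

T-forDistinctPairs : ∀ {m} (c : Fin m → Fin m → Bool) (P : Subset m) →
  T (forDistinctPairs c P) ⇔ (∀ {u v} → T (lookup P u) → T (lookup P v) → u ≢ v → T (c u v))
T-forDistinctPairs c P = mk⇔
  (λ t {u} {v} pu pv u≢v →
     to (pair⇔ u v) (to (T-all-allFin _) (to (T-all-allFin _) t u) v)
       (from (T-∈? u P) pu) (from (T-∈? v P) pv) (u≢v ∘ toWitness))
  (λ h → from (T-all-allFin _) λ u → from (T-all-allFin _) λ v →
     from (pair⇔ u v) λ pu pv ¬u≡v →
       h (to (T-∈? u P) pu) (to (T-∈? v P) pv) (¬u≡v ∘ fromWitness))
  where
  pair⇔ : ∀ u v → T (not (⌊ u ∈? P ⌋ ∧ ⌊ v ∈? P ⌋ ∧ not ⌊ u ≟ v ⌋) ∨ c u v) ⇔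
                  (T ⌊ u ∈? P ⌋ → T ⌊ v ∈? P ⌋ → ¬ T ⌊ u ≟ v ⌋ → T (c u v))
  pair⇔ u v = T-guarded ⌊ u ∈? P ⌋ ⌊ v ∈? P ⌋ ⌊ u ≟ v ⌋ (c u v)

Packing : {A : Set} → (A → A → Bool) → (A → Bool) → Set
Packing N P = ∀ {u v} → T (P u) → T (P v) → u ≢ v → ∀ w → T (N u w) → T (N v w) → ⊥

Packing-comap : {A B : Set} {N : A → A → Bool} {M : B → B → Bool} {Q : A → Bool} {P : B → Bool}
  {f : A → B} → Injective _≡_ _≡_ f → (∀ {x y} → T (N x y) → T (M (f x) (f y))) →
  (∀ {x} → T (Q x) → T (P (f x))) → Packing M P → Packing N Q
Packing-comap {f = f} f-inj N⇒M Q⇒P pack qu qv u≢v w nu nv =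
  pack (Q⇒P qu) (Q⇒P qv) (u≢v ∘ f-inj) (f w) (N⇒M nu) (N⇒M nv)

Packing-mono : {A : Set} {N : A → A → Bool} {Q P : A → Bool} →
  (∀ {x} → T (Q x) → T (P x)) → Packing N P → Packing N Q
Packing-mono = Packing-comap id id

disjointBy : ∀ {m} → (Fin m → Fin m → Bool) → Fin m → Fin m → Bool
disjointBy {m} N u v = all (λ w → not (N u w ∧ N v w)) (allFin m)

T-disjointBy : ∀ {m} (N : Fin m → Fin m → Bool) u v →
  T (disjointBy N u v) ⇔ (∀ w → T (N u w) → T (N v w) → ⊥)
T-disjointBy N u v = mk⇔
  (λ t w nu nv → to T-not (to (T-all-allFin _) t w) (from T-∧ (nu , nv)))
  (λ h → from (T-all-allFin _) λ w → from T-not λ nuv → let nu , nv = to T-∧ nuv in h w nu nv)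

T-packing : ∀ {m} (N : Fin m → Fin m → Bool) (P : Subset m) →
  T (forDistinctPairs (disjointBy N) P) ⇔ Packing N (lookup P)
T-packing N P = mk⇔
  (λ t {u} {v} pu pv u≢v → to (T-disjointBy N u v) (to (T-forDistinctPairs _ P) t pu pv u≢v))
  (λ h → from (T-forDistinctPairs _ P) λ {u} {v} pu pv u≢v → from (T-disjointBy N u v) (h pu pv u≢v))

∈⇒≤foldr-⊔ : ∀ {k ns} → k ∈ ns → k ≤ foldr _⊔_ 0 ns
∈⇒≤foldr-⊔ (here refl) = m≤m⊔n _ _
∈⇒≤foldr-⊔ {ns = n ∷ _} (there k∈ns) = ≤-trans (∈⇒≤foldr-⊔ k∈ns) (m≤n⊔m n _)

foldr-⊔-sel : ∀ ns → foldr _⊔_ 0 ns ≡ 0 ⊎ foldr _⊔_ 0 ns ∈ ns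
foldr-⊔-sel []       = inj₁ refl
foldr-⊔-sel (n ∷ ns) with ⊔-sel n (foldr _⊔_ 0 ns)
... | inj₁ ≡n = inj₂ (here ≡n)
... | inj₂ ≡rest with foldr-⊔-sel ns
...   | inj₁ ≡0    = inj₁ (trans ≡rest ≡0)
...   | inj₂ ∈rest = inj₂ (there (subst (_∈ ns) (sym ≡rest) ∈rest))

∈-allSubsets : ∀ {m} (P : Subset m) → P ∈ allSubsets m
∈-allSubsets []                  = here refl
∈-allSubsets (true ∷ P)          = ∈-++⁺ˡ (∈-map⁺ (true ∷_) (∈-allSubsets P))
∈-allSubsets {suc m} (false ∷ P) =
  ∈-++⁺ʳ (map (true ∷_) (allSubsets m)) (∈-map⁺ (false ∷_) (∈-allSubsets P))

maxSize-upper : ∀ {m} (p : Subset m → Bool) {P} → T (p P) → ∣ P ∣ ≤ maxSize p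
maxSize-upper p {P} pP = ∈⇒≤foldr-⊔ (∈-map⁺ ∣_∣ (∈-filter⁺ (T? ∘ p) (∈-allSubsets P) pP))

maxSize-attained : ∀ {m} (p : Subset m → Bool) → T (p Subset.⊥) → ∃[ P ] T (p P) × maxSize p ≡ ∣ P ∣
maxSize-attained {m} p p⊥ with foldr-⊔-sel (map ∣_∣ (filter (T? ∘ p) (allSubsets m)))
... | inj₁ ≡0 = Subset.⊥ , p⊥ , trans ≡0 (sym (∣⊥∣≡0 m))
... | inj₂ ∈sizes with ∈-map⁻ ∣_∣ ∈sizes
...   | P , P∈ , ≡∣P∣ = P , proj₂ (∈-filter⁻ (T? ∘ p) {xs = allSubsets m} P∈) , ≡∣P∣

-- ρₒ G and ρ G unfold to maxPacking (adj G) and maxPacking (inN[] G).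
module _ {m} (N : Fin m → Fin m → Bool) where

  maxPacking : ℕ
  maxPacking = maxSize (forDistinctPairs (disjointBy N))

  maxPacking-upper : ∀ {f} → Packing N f → count f ≤ maxPacking
  maxPacking-upper {f} pack = subst (_≤ maxPacking) (∣tabulate∣≡count f)
    (maxSize-upper (forDistinctPairs (disjointBy N)) (from (T-packing N (tabulate f))
      (Packing-mono (subst T (lookup∘tabulate f _)) pack)))

  maxPacking-attained : ∃[ f ] Packing N f × maxPacking ≡ count f
  maxPacking-attained with maxSize-attained (forDistinctPairs (disjointBy N)) (from (T-packing N Subset.⊥) ⊥-packing)
    where
    ⊥-packing : Packing N (lookup Subset.⊥)
    ⊥-packing {u} pu = ⊥-elim (subst T (lookup-replicate u false) pu)
  ... | P , P-packing , ≡∣P∣ = lookup P , to (T-packing N P) P-packing , trans ≡∣P∣ (∣∣≡count-lookup P)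

module _ (G : Graph) where

  iso#≡count : iso# G ≡ count (isIsolated G)
  iso#≡count = length-filter-tabulate (isIsolated G) id

  adj-sym : ∀ {u v} → T (adj G u v) → T (adj G v u)
  adj-sym {u} {v} = subst T (Graph.sym G u v)

  isolated⇒¬adj : ∀ {v w} → T (isIsolated G v) → ¬ T (adj G v w)
  isolated⇒¬adj {v} iso vw = to T-not iso (from (T-any-allFin (adj G v)) (_ , vw))

  ¬isolated⇒adj : ∀ {v} → ¬ T (isIsolated G v) → ∃[ w ] T (adj G v w)
  ¬isolated⇒adj {v} ¬iso = to (T-any-allFin (adj G v)) (decidable-stable (T? _) (¬iso ∘ from T-not))

  hasIsolated⇒isolated : T (hasIsolated G) → ∃[ v ] T (isIsolated G v)
  hasIsolated⇒isolated = to (T-any-allFin (isIsolated G))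

  ¬hasIsolated⇒¬isolated : ∀ {v} → ¬ T (hasIsolated G) → ¬ T (isIsolated G v)
  ¬hasIsolated⇒¬isolated ¬has iso = ¬has (from (T-any-allFin (isIsolated G)) (_ , iso))

  inN[]⁻ : ∀ {v w} → T (inN[] G v w) → v ≡ w ⊎ T (adj G v w)
  inN[]⁻ = Sum.map₁ toWitness ∘ to T-∨

  inN[]-refl : ∀ {v} → T (inN[] G v v)
  inN[]-refl {v} = from (T-∨ {⌊ v ≟ v ⌋}) (inj₁ (fromWitness refl))

  adj⇒inN[] : ∀ {v w} → T (adj G v w) → T (inN[] G v w)
  adj⇒inN[] {v} {w} = from (T-∨ {⌊ v ≟ w ⌋}) ∘ inj₂

  isolated-inN[] : ∀ {v w} → T (isIsolated G v) → T (inN[] G v w) → v ≡ w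
  isolated-inN[] iso vw = Sum.[ id , ⊥-elim ∘ isolated⇒¬adj iso ] (inN[]⁻ vw)

  isolated-separated : ∀ {u v w} → T (isIsolated G u) → u ≢ v → T (inN[] G u w) → ¬ T (inN[] G v w)
  isolated-separated iso u≢v uw vw with isolated-inN[] iso uw
  ... | refl = Sum.[ u≢v ∘ sym , isolated⇒¬adj iso ∘ adj-sym ] (inN[]⁻ vw)

module _ (G H : Graph) where

  pairAdj⁻ : ∀ {g h w k} → T (pairAdj G H (g , h) (w , k)) → T (adj G g w) ⊎ (g ≡ w × T (adj H h k))
  pairAdj⁻ = Sum.map₂ (Product.map₁ toWitness ∘ to T-∧) ∘ to T-∨

  pairAdj-G : ∀ {g h w k} → T (adj G g w) → T (pairAdj G H (g , h) (w , k))
  pairAdj-G = from T-∨ ∘ inj₁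

  pairAdj-H : ∀ {g h k} → T (adj H h k) → T (pairAdj G H (g , h) (g , k))
  pairAdj-H {g} hk = from (T-∨ {adj G g g}) (inj₂ (from T-∧ (fromWitness refl , hk)))

  inN[]⇒pairAdj : ∀ {g w h k} → T (inN[] G g w) → (g ≡ w → T (adj H h k)) → T (pairAdj G H (g , h) (w , k))
  inN[]⇒pairAdj gw hk with inN[]⁻ G gw
  ... | inj₁ refl = pairAdj-H (hk refl)
  ... | inj₂ gw′  = pairAdj-G gw′

  pairAdj⇒inN[] : ∀ {g h w k} → T (pairAdj G H (g , h) (w , k)) → T (inN[] G g w)
  pairAdj⇒inN[] gh~wk with pairAdj⁻ gh~wk
  ... | inj₁ gw         = adj⇒inN[] G gw
  ... | inj₂ (refl , _) = inN[]-refl G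

  lex⇒pairs : ∀ {f} → Packing (adj (G ∘ₗ H)) f → Packing (pairAdj G H) (uncurry (fibre f))
  lex⇒pairs = Packing-comap (Injection.injective (↔⇒↣ (↔-sym *↔×))) pairAdj⇒lexAdj id
    where
    pairAdj⇒lexAdj : ∀ {x y} → T (pairAdj G H x y) → T (lexAdj G H (uncurry combine x) (uncurry combine y))
    pairAdj⇒lexAdj {g , h} {w , k} =
      subst T (sym (cong₂ (pairAdj G H) (remQuot-combine {n G} {n H} g h) (remQuot-combine w k)))

  pairs⇒lex : ∀ {R} → Packing (pairAdj G H) (uncurry R) → Packing (adj (G ∘ₗ H)) (uncurry R ∘ remQuot (n H))
  pairs⇒lex = Packing-comap (Injection.injective (↔⇒↣ *↔×)) id id

module _ (G H : Graph) {R : Fin (n G) → Fin (n H) → Bool} where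

  shadow : Fin (n G) → Bool
  shadow g = isIsolated G g ∨ any (R g) (allFin (n H))

  shadow⁻ : ∀ {g} → T (shadow g) → T (isIsolated G g) ⊎ ∃[ h ] T (R g h)
  shadow⁻ = Sum.map₂ (to (T-any-allFin _)) ∘ to T-∨

  module _ (R-packing : Packing (pairAdj G H) (uncurry R)) where

    fibre-openPacking : ∀ g → Packing (adj H) (R g)
    fibre-openPacking g rh rh' h≢h' k hk h'k =
      R-packing rh rh' (h≢h' ∘ cong proj₂) (g , k) (pairAdj-H G H hk) (pairAdj-H G H h'k)

    fibre-unique : ∀ {g w} → T (adj G g w) → ∀ {h h'} → T (R g h) → T (R g h') → h ≡ h'
    fibre-unique {w = w} gw {h} {h'} rh rh' = decidable-stable (h ≟ h') λ h≢h' →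
      R-packing rh rh' (h≢h' ∘ cong proj₂) (w , h) (pairAdj-G G H gw) (pairAdj-G G H gw)

    shadow-openPacking : Packing (adj G) shadow
    shadow-openPacking su sv u≢v w uw vw with shadow⁻ su | shadow⁻ sv
    ... | inj₁ iso      | _              = isolated⇒¬adj G iso uw
    ... | inj₂ _        | inj₁ iso       = isolated⇒¬adj G iso vw
    ... | inj₂ (h , rh) | inj₂ (h' , rh') =
      R-packing rh rh' (u≢v ∘ cong proj₁) (w , h) (pairAdj-G G H uw) (pairAdj-G G H vw)

    shadow-packing : (∀ h → ∃[ k ] T (adj H h k)) → Packing (inN[] G) shadow
    shadow-packing nbr {u} {v} su sv u≢v w uw vw with shadow⁻ su | shadow⁻ sv
    ... | inj₁ iso      | _              = isolated-separated G iso u≢v uw vw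
    ... | inj₂ _        | inj₁ iso       = isolated-separated G iso (u≢v ∘ sym) vw uw
    ... | inj₂ (h , rh) | inj₂ (h' , rh') with inN[]⁻ G uw
    ...   | inj₁ refl = let k , hk = nbr h in
      R-packing rh rh' (u≢v ∘ cong proj₁) (u , k) (pairAdj-H G H hk) (inN[]⇒pairAdj G H vw (⊥-elim ∘ u≢v ∘ sym))
    ...   | inj₂ uw′  = let k , h'k = nbr h' in
      R-packing rh rh' (u≢v ∘ cong proj₁) (w , k) (pairAdj-G G H uw′) (inN[]⇒pairAdj G H vw λ _ → h'k)

    fibre-weight : ∀ g →
      count (R g) + iverson (isIsolated G g) ≤ (if isIsolated G g then ρₒ H else 0) + iverson (shadow g)
    fibre-weight g with isIsolated G g in iso
    ... | true  = +-monoˡ-≤ 1 (maxPacking-upper (adj H) (fibre-openPacking g))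
    ... | false = let _ , gw = ¬isolated⇒adj G (subst T iso) in
      ≤-trans (≤-reflexive (+-identityʳ _)) (count≤iverson-any (R g) (fibre-unique gw))

ρₒ-lex-upper : (G H : Graph) (X : ℕ) →
  (∀ {R} → Packing (pairAdj G H) (uncurry R) → count (shadow G H {R}) ≤ X) →
  ρₒ (G ∘ₗ H) ≤ X + iso# G * ρₒ H ∸ iso# G
ρₒ-lex-upper G H X shadow≤X rewrite iso#≡count G with maxPacking-attained (adj (G ∘ₗ H))
... | f , f-packing , ρₒ≡ = subst (_≤ X + ι * ρₒ H ∸ ι) (sym ρₒ≡) (m+n≤o⇒m≤o∸n (count f) (begin
  count f + ι                                         ≡⟨ cong (_+ ι) (count-fibres {n G} {n H} f) ⟩
  sum (count ∘ R) + ι                                 ≡⟨ ∑-distrib-+ (count ∘ R) (iverson ∘ isIsolated G) ⟨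
  sum (λ g → count (R g) + iverson (isIsolated G g))  ≤⟨ sum-mono-≤ (fibre-weight G H R-packing) ⟩
  sum (λ g → (if isIsolated G g then ρₒ H else 0) + iverson (shadow G H {R} g))
                                                      ≡⟨ sum-weight (isIsolated G) (shadow G H {R}) (ρₒ H) ⟩
  ι * ρₒ H + count (shadow G H {R})                   ≤⟨ +-monoʳ-≤ (ι * ρₒ H) (shadow≤X R-packing) ⟩
  ι * ρₒ H + X                                        ≡⟨ +-comm (ι * ρₒ H) X ⟩
  X + ι * ρₒ H                                        ∎))
  where
  open ≤-Reasoning
  ι : ℕ
  ι = count (isIsolated G)
  R : Fin (n G) → Fin (n H) → Bool
  R = fibre f
  R-packing : Packing (pairAdj G H) (uncurry R)
  R-packing = lex⇒pairs G H f-packing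

module _ (G H : Graph) where

  layer : (Fin (n G) → Bool) → Fin (n H) → Fin (n G) → Fin (n H) → Bool
  layer S h₀ g h = S g ∧ ⌊ h ≟ h₀ ⌋

  layer⁻ : ∀ {S h₀ g h} → T (layer S h₀ g h) → T (S g) × h ≡ h₀
  layer⁻ = Product.map₂ toWitness ∘ to T-∧

  layer-openPacking : ∀ {S h₀} → T (isIsolated H h₀) → Packing (adj G) S →
    Packing (pairAdj G H) (uncurry (layer S h₀))
  layer-openPacking {S} {h₀} h₀-iso S-packing {g , h} {g' , h'} x y x≢y (w , k) xz yz
    with layer⁻ {S} x | layer⁻ {S} y
  ... | sg , refl | sg' , refl with pairAdj⁻ G H xz | pairAdj⁻ G H yz
  ...   | inj₂ (_ , hk) | _             = isolated⇒¬adj H h₀-iso hk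
  ...   | inj₁ _        | inj₂ (_ , hk) = isolated⇒¬adj H h₀-iso hk
  ...   | inj₁ gw       | inj₁ g'w      = S-packing sg sg' (x≢y ∘ cong (_, h₀)) w gw g'w

  layer-packing : ∀ {S h₀} → Packing (inN[] G) S → Packing (pairAdj G H) (uncurry (layer S h₀))
  layer-packing {S} {h₀} S-packing {g , h} {g' , h'} x y x≢y (w , k) xz yz
    with layer⁻ {S} x | layer⁻ {S} y
  ... | sg , refl | sg' , refl =
    S-packing sg sg' (x≢y ∘ cong (_, h₀)) w (pairAdj⇒inN[] G H xz) (pairAdj⇒inN[] G H yz)

  module _ (S : Fin (n G) → Bool) (P : Fin (n H) → Bool) (h₀ : Fin (n H)) where

    lowerSet : Fin (n G) → Fin (n H) → Bool
    lowerSet g h = if isIsolated G g then P h else layer S h₀ g h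

    lowerSet-isolated : ∀ {g h} → T (isIsolated G g) → T (lowerSet g h) → T (P h)
    lowerSet-isolated {g} iso with isIsolated G g
    ... | true = id

    lowerSet-¬isolated : ∀ {g h} → ¬ T (isIsolated G g) → T (lowerSet g h) → T (layer S h₀ g h)
    lowerSet-¬isolated {g} ¬iso with isIsolated G g
    ... | true  = ⊥-elim (¬iso _)
    ... | false = id

    isolated-column-separated : Packing (adj H) P → ∀ {g h g' h' z} → T (isIsolated G g) →
      T (lowerSet g h) → T (lowerSet g' h') → (g , h) ≢ (g' , h') →
      T (pairAdj G H (g , h) z) → T (pairAdj G H (g' , h') z) → ⊥
    isolated-column-separated P-packing {g} {z = w , k} iso x y x≢y xz yz with pairAdj⁻ G H xz
    ... | inj₁ gw = isolated⇒¬adj G iso gw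
    ... | inj₂ (refl , hk) with pairAdj⁻ G H yz
    ...   | inj₁ g'g          = isolated⇒¬adj G iso (adj-sym G g'g)
    ...   | inj₂ (refl , h'k) =
      P-packing (lowerSet-isolated iso x) (lowerSet-isolated iso y) (x≢y ∘ cong (g ,_)) k hk h'k

    lowerSet-packing : Packing (adj H) P → Packing (pairAdj G H) (uncurry (layer S h₀)) →
      Packing (pairAdj G H) (uncurry lowerSet)
    lowerSet-packing P-packing L-packing {g , h} {g' , h'} x y x≢y z xz yz
      with T? (isIsolated G g) | T? (isIsolated G g')
    ... | yes iso | _        = isolated-column-separated P-packing iso x y x≢y xz yz
    ... | no _    | yes iso' = isolated-column-separated P-packing iso' y x (x≢y ∘ sym) yz xz
    ... | no ¬iso | no ¬iso' = L-packing (lowerSet-¬isolated ¬iso x) (lowerSet-¬isolated ¬iso' y) x≢y z xz yz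

    lowerSet-weight : ρₒ H ≤ count P → ∀ g →
      (if isIsolated G g then ρₒ H else 0) + iverson (S g) ≤ count (lowerSet g) + iverson (isIsolated G g)
    lowerSet-weight ρₒH≤ g with isIsolated G g
    ... | true  = +-mono-≤ ρₒH≤ (iverson≤1 (S g))
    ... | false with S g
    ...   | false = z≤n
    ...   | true  = ≤-trans (count-pos _ h₀ (fromWitness refl)) (m≤m+n _ 0)

ρₒ-lex-lower : (G H : Graph) {S : Fin (n G) → Bool} (h₀ : Fin (n H)) →
  Packing (pairAdj G H) (uncurry (layer G H S h₀)) → count S + iso# G * ρₒ H ∸ iso# G ≤ ρₒ (G ∘ₗ H)
ρₒ-lex-lower G H {S} h₀ L-packing rewrite iso#≡count G with maxPacking-attained (adj H)
... | P , P-packing , ρₒH≡ = m≤n+o⇒m∸n≤o (count S + ι * ρₒ H) ι (begin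
  count S + ι * ρₒ H                                    ≡⟨ +-comm (count S) (ι * ρₒ H) ⟩
  ι * ρₒ H + count S                                    ≡⟨ sum-weight (isIsolated G) S (ρₒ H) ⟨
  sum (λ g → (if isIsolated G g then ρₒ H else 0) + iverson (S g))
                                                        ≤⟨ sum-mono-≤ (lowerSet-weight G H S P h₀ (≤-reflexive ρₒH≡)) ⟩
  sum (λ g → count (Q g) + iverson (isIsolated G g))    ≡⟨ ∑-distrib-+ (count ∘ Q) (iverson ∘ isIsolated G) ⟩
  sum (count ∘ Q) + ι                                   ≡⟨ cong (_+ ι) (count-unfibre Q) ⟨
  count (uncurry Q ∘ remQuot (n H)) + ι                 ≤⟨ +-monoˡ-≤ ι (maxPacking-upper (adj (G ∘ₗ H)) Q-packing) ⟩
  ρₒ (G ∘ₗ H) + ι                                       ≡⟨ +-comm (ρₒ (G ∘ₗ H)) ι ⟩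
  ι + ρₒ (G ∘ₗ H)                                       ∎)
  where
  open ≤-Reasoning
  ι : ℕ
  ι = count (isIsolated G)
  Q : Fin (n G) → Fin (n H) → Bool
  Q = lowerSet G H S P h₀
  Q-packing : Packing (adj (G ∘ₗ H)) (uncurry Q ∘ remQuot (n H))
  Q-packing = pairs⇒lex G H (lowerSet-packing G H S P h₀ P-packing L-packing)

ρₒ-lex-hasIsolated : (G H : Graph) → T (hasIsolated H) → ρₒ (G ∘ₗ H) ≡ ρₒ G + iso# G * ρₒ H ∸ iso# G
ρₒ-lex-hasIsolated G H has with hasIsolated⇒isolated H has | maxPacking-attained (adj G)
... | h₀ , h₀-iso | S , S-packing , ρₒG≡ = ≤-antisym
  (ρₒ-lex-upper G H (ρₒ G) λ R-packing → maxPacking-upper (adj G) (shadow-openPacking G H R-packing))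
  (subst (λ k → k + iso# G * ρₒ H ∸ iso# G ≤ ρₒ (G ∘ₗ H)) (sym ρₒG≡)
    (ρₒ-lex-lower G H h₀ (layer-openPacking G H h₀-iso S-packing)))

ρₒ-lex-noIsolated : (G H : Graph) → ¬ T (hasIsolated H) → Fin (n H) →
  ρₒ (G ∘ₗ H) ≡ ρ G + iso# G * ρₒ H ∸ iso# G
ρₒ-lex-noIsolated G H ¬has h₀ with maxPacking-attained (inN[] G)
... | S , S-packing , ρG≡ = ≤-antisym
  (ρₒ-lex-upper G H (ρ G) λ R-packing → maxPacking-upper (inN[] G) (shadow-packing G H R-packing noIsolated))
  (subst (λ k → k + iso# G * ρₒ H ∸ iso# G ≤ ρₒ (G ∘ₗ H)) (sym ρG≡)
    (ρₒ-lex-lower G H h₀ (layer-packing G H S-packing)))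
  where
  noIsolated : ∀ h → ∃[ k ] T (adj H h k)
  noIsolated h = ¬isolated⇒adj H (¬hasIsolated⇒¬isolated H ¬has)

theorem7 : (G H : Graph) → 1 ≤ n H →
    ρₒ (G ∘ₗ H)
      ≡ (if hasIsolated H
           then ρₒ G + iso# G * ρₒ H ∸ iso# G
           else ρ G + iso# G * ρₒ H ∸ iso# G)
theorem7 G H 1≤∣H∣ with hasIsolated H in has
... | true  = ρₒ-lex-hasIsolated G H (from T-≡ has)
... | false = ρₒ-lex-noIsolated G H (subst T has) (fromℕ< 1≤∣H∣)
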